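{- Let $n\ge 1$ and let $G$ be a graph of order $2^n$. Then $\operatorname{dil}(G,Q_n)\leq n-1$ if and only if $G$ contains a perfect anti-matching.
   Context: $Q_n$ is the $n$-dimensional hypercube: vertex set $\{0,1\}^n$, two vertices adjacent iff they differ in exactly one coordinate. An embedding of a graph $G$ into a graph $H$ is a pair $(f,P_f)$ where $f:V(G)\to V(H)$ is injective and $P_f$ assigns to each edge $uv\in E(G)$ a path in $H$ between $f(u)$ and $f(v)$. The dilation of an edge $e$ under the embedding is the length of $P_f(e)$; the dilation of the embedding is the maximum over edges of $G$; and $\operatorname{dil}(G,H)$ is the minimum dilation over all embeddings of $G$ into $H$ (equivalently $\min_f\max_{uv\in E(G)} d_H(f(u),f(v))$ over injections $f$). A set of vertex pairs $\{\{x_1,y_1\},\dots,\{x_k,y_k\}\}$ of $G$ is an anti-matching if the pairs are pairwise disjoint and $x_iy_i\notin E(G)$ for all $i$ (i.e. the pairs form a matching in the complement of $G$); it is a perfect anti-matching if $2k=|V(G)|$. -}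

module Defs where

open import Data.Nat using (ℕ; zero; suc; _≤_; _∸_; _*_; _^_)
open import Data.Fin using (Fin)
open import Data.Bool using (Bool)
open import Data.Vec using (Vec; lookup)
open import Data.Product using (Σ; ∃; _×_; _,_; proj₁; proj₂)
open import Data.Sum using (_⊎_; inj₁; inj₂)
open import Relation.Binary.PropositionalEquality using (_≡_; _≢_)
open import Relation.Nullary using (¬_)
open import Function.Definitions using (Injective)

record Graph (N : ℕ) : Set₁ where
  field
    Adj   : Fin N → Fin N → Set
    sym   : ∀ {u v} → Adj u v → Adj v u
    irrefl : ∀ {u} → ¬ Adj u u
open Graph public

QVertex : ℕ → Set
QVertex n = Vec Bool n

QAdj : ∀ {n} → QVertex n → QVertex n → Set
QAdj {n} x y = Σ (Fin n) λ i →
  (lookup x i ≢ lookup y i) × (∀ j → j ≢ i → lookup x j ≡ lookup y j)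

data QPath {n : ℕ} : QVertex n → QVertex n → ℕ → Set where
  here : ∀ {x} → QPath x x 0
  step : ∀ {x y z ℓ} → QAdj x y → QPath y z ℓ → QPath x z (suc ℓ)

record EmbeddingDil {N : ℕ} (G : Graph N) (n k : ℕ) : Set where
  field
    f     : Fin N → QVertex n
    f-inj : Injective _≡_ _≡_ f
    P     : ∀ {u v} → Adj G u v → Σ ℕ λ ℓ → QPath (f u) (f v) ℓ × ℓ ≤ k

-- dil(G, Q_n) ≤ k  :⇔  some embedding of G into Q_n has dilation ≤ k
-- (dil is the minimum over the finitely many embeddings).
DilAtMost : ∀ {N} → Graph N → ℕ → ℕ → Set
DilAtMost G n k = EmbeddingDil G n k

endpoint : ∀ {N k} → (Fin k → Fin N × Fin N) → Fin k ⊎ Fin k → Fin N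
endpoint p (inj₁ i) = proj₁ (p i)
endpoint p (inj₂ i) = proj₂ (p i)

-- An anti-matching with k pairs {x_i, y_i}: the 2k endpoints are pairwise
-- distinct (each pair is a genuine 2-set and the pairs are pairwise disjoint),
-- and x_i y_i ∉ E(G) for all i.
record AntiMatching {N : ℕ} (G : Graph N) (k : ℕ) : Set where
  field
    pair     : Fin k → Fin N × Fin N
    distinct : Injective _≡_ _≡_ (endpoint pair)
    nonAdj   : ∀ i → ¬ Adj G (proj₁ (pair i)) (proj₂ (pair i))

HasPerfectAntiMatching : ∀ {N} → Graph N → Set
HasPerfectAntiMatching {N} G = Σ ℕ λ k → (2 * k ≡ N) × AntiMatching G k

-- The distance in Q_n is the Hamming distance, so the pairs at distance n
-- are exactly the 2^(n-1) antipodal pairs {x, x̄}, and every other pair is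
-- joined by a path of length at most n - 1.  Since |V(G)| = |V(Q_n)|, an
-- embedding is a bijection; one of dilation ≤ n - 1 pulls the antipodal pairs
-- back to a perfect anti-matching.  Conversely, sending the two ends of the
-- i-th pair of a perfect anti-matching to the two ends of the i-th antipodal
-- pair gives an embedding under which no edge is mapped onto an antipodal pair.
module Submission where

open import Defs hiding (sym)
open import Algebra.Properties.CommutativeSemigroup using (interchange)
open import Data.Bool using (Bool; true; false; not)
open import Data.Bool.Properties using (not-involutive)
open import Data.Empty using (⊥-elim)
open import Data.Fin using (Fin; zero; suc; punchOut)
open import Data.Fin.Properties
  using (any?; _≟_; punchOut-injective; injective⇒≤; suc-injective; 2↔Bool; *↔×; +↔⊎)
open import Data.Nat using (ℕ; zero; suc; _+_; _≤_; _∸_; _^_; z≤n; s≤s)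
open import Data.Nat.Properties
  using (≤-trans; ≤-reflexive; +-mono-≤; 1+n≰n; ≤∧≢⇒<; <⇒≤pred; +-identityʳ; *-cancelˡ-≡;
         +-commutativeSemigroup; module ≤-Reasoning)
import Data.Nat.Properties as ℕ
open import Data.Product using (∃; _×_; _,_; proj₁; proj₂; uncurry)
open import Data.Product.Function.NonDependent.Propositional using (_×-↔_)
open import Data.Sum using (_⊎_; inj₁; inj₂; swap)
open import Data.Vec using (Vec; []; _∷_; lookup; map; uncons)
open import Data.Vec.Properties using (∷-injectiveʳ)
open import Function using (_∘_)
open import Function.Bundles using (_⇔_; mk⇔; _↣_; _↔_; mk↣; mk↔ₛ′; Injection; Inverse)
open import Function.Construct.Identity using (↣-id)
open import Function.Definitions using (Injective; StrictlySurjective)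
open import Function.Properties.Inverse using (↔-sym; ↔-trans; ↔⇒↣)
open import Relation.Binary.PropositionalEquality
  using (_≡_; _≢_; refl; sym; trans; cong; cong₂; subst; subst₂)
open import Relation.Nullary using (¬_; yes; no; contradiction)

open Injection using (to; injective)

Fin-injective⇒strictlySurjective : ∀ {n} {f : Fin n → Fin n} →
  Injective _≡_ _≡_ f → StrictlySurjective _≡_ f
Fin-injective⇒strictlySurjective {suc n} {f} f-injective y with any? (λ x → f x ≟ y)
... | yes hit  = hit
... | no  miss = contradiction (injective⇒≤ {f = f-avoiding-y} f-avoiding-y-injective) 1+n≰n
  where
  y≢f : ∀ x → y ≢ f x
  y≢f x y≡fx = miss (x , sym y≡fx)

  f-avoiding-y : Fin (suc n) → Fin n
  f-avoiding-y x = punchOut (y≢f x)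

  f-avoiding-y-injective : Injective _≡_ _≡_ f-avoiding-y
  f-avoiding-y-injective = f-injective ∘ punchOut-injective (y≢f _) (y≢f _)

↣⇒↔ : ∀ {a b} {A : Set a} {B : Set b} {n} → (f : A ↣ B) → Fin n ↣ A → B ↣ Fin n → A ↔ B
↣⇒↔ {A = A} {B} f h g = mk↔ₛ′ (to f) from to∘from (λ a → injective f (to∘from (to f a)))
  where
  round-trip-surjective : StrictlySurjective _≡_ (to g ∘ to f ∘ to h)
  round-trip-surjective =
    Fin-injective⇒strictlySurjective (injective h ∘ injective f ∘ injective g)

  from : B → A
  from b = to h (proj₁ (round-trip-surjective (to g b)))

  to∘from : ∀ b → to f (from b) ≡ b
  to∘from b = injective g (proj₂ (round-trip-surjective (to g b)))

Vec-suc↔× : ∀ {a} {A : Set a} {n} → Vec A (suc n) ↔ (A × Vec A n)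
Vec-suc↔× = mk↔ₛ′ uncons (uncurry _∷_) (λ _ → refl) (λ { (x ∷ xs) → refl })

Vec-Bool↔Fin : ∀ n → Vec Bool n ↔ Fin (2 ^ n)
Vec-Bool↔Fin zero    = mk↔ₛ′ (λ _ → zero) (λ _ → []) (λ { zero → refl }) (λ { [] → refl })
Vec-Bool↔Fin (suc n) =
  ↔-trans Vec-suc↔× (↔-trans (↔-sym 2↔Bool ×-↔ Vec-Bool↔Fin n) (↔-sym *↔×))

lookup-extensionality : ∀ {a} {A : Set a} {n} {x y : Vec A n} →
  (∀ i → lookup x i ≡ lookup y i) → x ≡ y
lookup-extensionality {x = []}    {[]}    _ = refl
lookup-extensionality {x = a ∷ x} {b ∷ y} agree =
  cong₂ _∷_ (agree zero) (lookup-extensionality (agree ∘ suc))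

map-not-involutive : ∀ {n} (x : Vec Bool n) → map not (map not x) ≡ x
map-not-involutive []      = refl
map-not-involutive (a ∷ x) = cong₂ _∷_ (not-involutive a) (map-not-involutive x)

map-not-injective : ∀ {n} {x y : Vec Bool n} → map not x ≡ map not y → x ≡ y
map-not-injective {x = x} {y} eq =
  trans (sym (map-not-involutive x)) (trans (cong (map not) eq) (map-not-involutive y))

bitDistance : Bool → Bool → ℕ
bitDistance false true  = 1
bitDistance true  false = 1
bitDistance _     _     = 0

bitDistance-self : ∀ a → bitDistance a a ≡ 0
bitDistance-self false = refl
bitDistance-self true  = refl

bitDistance≤1 : ∀ a b → bitDistance a b ≤ 1
bitDistance≤1 false false = z≤n
bitDistance≤1 false true  = s≤s z≤n
bitDistance≤1 true  false = s≤s z≤n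
bitDistance≤1 true  true  = z≤n

bitDistance-triangle : ∀ a b c → bitDistance a c ≤ bitDistance a b + bitDistance b c
bitDistance-triangle false false c     = ≤-reflexive refl
bitDistance-triangle true  true  c     = ≤-reflexive refl
bitDistance-triangle false true  false = z≤n
bitDistance-triangle false true  true  = s≤s z≤n
bitDistance-triangle true  false false = s≤s z≤n
bitDistance-triangle true  false true  = z≤n

hamming : ∀ {n} → Vec Bool n → Vec Bool n → ℕ
hamming []      []      = 0
hamming (a ∷ x) (b ∷ y) = bitDistance a b + hamming x y

hamming-self : ∀ {n} (x : Vec Bool n) → hamming x x ≡ 0
hamming-self []      = refl
hamming-self (a ∷ x) = cong₂ _+_ (bitDistance-self a) (hamming-self x)

hamming-complement : ∀ {n} (x : Vec Bool n) → hamming x (map not x) ≡ n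
hamming-complement []          = refl
hamming-complement (false ∷ x) = cong suc (hamming-complement x)
hamming-complement (true  ∷ x) = cong suc (hamming-complement x)

hamming≤length : ∀ {n} (x y : Vec Bool n) → hamming x y ≤ n
hamming≤length []      []      = z≤n
hamming≤length (a ∷ x) (b ∷ y) = +-mono-≤ (bitDistance≤1 a b) (hamming≤length x y)

hamming-triangle : ∀ {n} (x y z : Vec Bool n) → hamming x z ≤ hamming x y + hamming y z
hamming-triangle []      []      []      = z≤n
hamming-triangle (a ∷ x) (b ∷ y) (c ∷ z) = begin
  bitDistance a c + hamming x z
    ≤⟨ +-mono-≤ (bitDistance-triangle a b c) (hamming-triangle x y z) ⟩
  (bitDistance a b + bitDistance b c) + (hamming x y + hamming y z)
    ≡⟨ interchange +-commutativeSemigroup (bitDistance a b) _ _ _ ⟩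
  (bitDistance a b + hamming x y) + (bitDistance b c + hamming y z) ∎
  where open ≤-Reasoning

hamming≡length⇒complement : ∀ {n} (x y : Vec Bool n) → hamming x y ≡ n → y ≡ map not x
hamming≡length⇒complement []          []          _  = refl
hamming≡length⇒complement (false ∷ x) (true  ∷ y) eq =
  cong (true ∷_) (hamming≡length⇒complement x y (ℕ.suc-injective eq))
hamming≡length⇒complement (true  ∷ x) (false ∷ y) eq =
  cong (false ∷_) (hamming≡length⇒complement x y (ℕ.suc-injective eq))
hamming≡length⇒complement (false ∷ x) (false ∷ y) eq =
  ⊥-elim (1+n≰n (subst (_≤ _) eq (hamming≤length x y)))
hamming≡length⇒complement (true  ∷ x) (true  ∷ y) eq =
  ⊥-elim (1+n≰n (subst (_≤ _) eq (hamming≤length x y)))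

QAdj-∷ : ∀ {n} (a : Bool) {x y : Vec Bool n} → QAdj x y → QAdj (a ∷ x) (a ∷ y)
QAdj-∷ a (i , differ , agree) = suc i , differ , λ
  { zero    _      → refl
  ; (suc j) sj≢si → agree j (sj≢si ∘ cong suc) }

QAdj-head : ∀ {n} {a b : Bool} (x : Vec Bool n) → a ≢ b → QAdj (a ∷ x) (b ∷ x)
QAdj-head x a≢b = zero , a≢b , λ
  { zero    0≢0 → contradiction refl 0≢0
  ; (suc j) _   → refl }

QPath-∷ : ∀ {n} (a : Bool) {x y : Vec Bool n} {ℓ} → QPath x y ℓ → QPath (a ∷ x) (a ∷ y) ℓ
QPath-∷ a here         = here
QPath-∷ a (step xy p) = step (QAdj-∷ a xy) (QPath-∷ a p)

geodesic : ∀ {n} (x y : Vec Bool n) → QPath x y (hamming x y)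
geodesic []          []          = here
geodesic (false ∷ x) (false ∷ y) = QPath-∷ false (geodesic x y)
geodesic (true  ∷ x) (true  ∷ y) = QPath-∷ true (geodesic x y)
geodesic (false ∷ x) (true  ∷ y) = step (QAdj-head x λ ()) (QPath-∷ true (geodesic x y))
geodesic (true  ∷ x) (false ∷ y) = step (QAdj-head x λ ()) (QPath-∷ false (geodesic x y))

QAdj⇒hamming≤1 : ∀ {n} {x y : Vec Bool n} → QAdj x y → hamming x y ≤ 1
QAdj⇒hamming≤1 {x = a ∷ x} {b ∷ y} (zero , _ , agree)
  with refl ← lookup-extensionality {x = x} {y} (λ j → agree (suc j) λ ())
  rewrite hamming-self x | +-identityʳ (bitDistance a b) = bitDistance≤1 a b
QAdj⇒hamming≤1 {x = a ∷ x} {b ∷ y} (suc i , differ , agree)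
  with refl ← agree zero (λ ())
  rewrite bitDistance-self a =
  QAdj⇒hamming≤1 {x = x} {y} (i , differ , λ j j≢i → agree (suc j) (j≢i ∘ suc-injective))

hamming≤QPath-length : ∀ {n} {x y : Vec Bool n} {ℓ} → QPath x y ℓ → hamming x y ≤ ℓ
hamming≤QPath-length {x = x} here = ≤-reflexive (hamming-self x)
hamming≤QPath-length {x = x} {z} {suc ℓ} (step {y = y} xy p) = begin
  hamming x z               ≤⟨ hamming-triangle x y z ⟩
  hamming x y + hamming y z ≤⟨ +-mono-≤ (QAdj⇒hamming≤1 {x = x} {y} xy) (hamming≤QPath-length p) ⟩
  suc ℓ                     ∎
  where open ≤-Reasoning

QPath-complement-length : ∀ {n} {x : Vec Bool n} {ℓ} → QPath x (map not x) ℓ → n ≤ ℓ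
QPath-complement-length {x = x} p = subst (_≤ _) (hamming-complement x) (hamming≤QPath-length p)

non-antipodal⇒short-QPath : ∀ {n} (x y : Vec Bool n) → y ≢ map not x →
  ∃ λ ℓ → QPath x y ℓ × ℓ ≤ n ∸ 1
non-antipodal⇒short-QPath x y y≢x̄ = hamming x y , geodesic x y ,
  <⇒≤pred (≤∧≢⇒< (hamming≤length x y) (y≢x̄ ∘ hamming≡length⇒complement x y))

antipodalCode : ∀ {k m} → (Fin k → Vec Bool m) → Fin k ⊎ Fin k → Vec Bool (suc m)
antipodalCode e (inj₁ i) = false ∷ e i
antipodalCode e (inj₂ i) = true ∷ map not (e i)

antipodalCode-injective : ∀ {k m} {e : Fin k → Vec Bool m} →
  Injective _≡_ _≡_ e → Injective _≡_ _≡_ (antipodalCode e)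
antipodalCode-injective e-injective {inj₁ i} {inj₁ j} eq =
  cong inj₁ (e-injective (∷-injectiveʳ eq))
antipodalCode-injective e-injective {inj₂ i} {inj₂ j} eq =
  cong inj₂ (e-injective (map-not-injective (∷-injectiveʳ eq)))

antipodalCode-swap : ∀ {k m} (e : Fin k → Vec Bool m) s →
  antipodalCode e (swap s) ≡ map not (antipodalCode e s)
antipodalCode-swap e (inj₁ i) = refl
antipodalCode-swap e (inj₂ i) = cong (false ∷_) (sym (map-not-involutive (e i)))

antipodalCode-complement⇒swap : ∀ {k m} {e : Fin k → Vec Bool m} → Injective _≡_ _≡_ e →
  ∀ {s t} → antipodalCode e t ≡ map not (antipodalCode e s) → t ≡ swap s
antipodalCode-complement⇒swap {e = e} e-injective {s} eq =
  antipodalCode-injective e-injective (trans eq (sym (antipodalCode-swap e s)))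

antiMatching : ∀ {N k} {G : Graph N} (g : Fin k ⊎ Fin k → Fin N) → Injective _≡_ _≡_ g →
  (∀ i → ¬ Adj G (g (inj₁ i)) (g (inj₂ i))) → AntiMatching G k
antiMatching {N} {k} g g-injective g-nonAdj = record
  { pair     = pair
  ; distinct = λ {s} {t} eq → g-injective (subst₂ _≡_ (endpoint-pair s) (endpoint-pair t) eq)
  ; nonAdj   = g-nonAdj
  }
  where
  pair : Fin k → Fin N × Fin N
  pair i = g (inj₁ i) , g (inj₂ i)

  endpoint-pair : ∀ s → endpoint pair s ≡ g s
  endpoint-pair (inj₁ i) = refl
  endpoint-pair (inj₂ i) = refl

AntiMatching-nonAdj-swap : ∀ {N k} {G : Graph N} (A : AntiMatching G k) s →
  let open AntiMatching A in ¬ Adj G (endpoint pair s) (endpoint pair (swap s))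
AntiMatching-nonAdj-swap A (inj₁ i) = AntiMatching.nonAdj A i
AntiMatching-nonAdj-swap {G = G} A (inj₂ i) = AntiMatching.nonAdj A i ∘ Graph.sym G

Fin↣Vec-Bool : ∀ m → Fin (2 ^ m) ↣ Vec Bool m
Fin↣Vec-Bool m = ↔⇒↣ (↔-sym (Vec-Bool↔Fin m))

DilAtMost⇒HasPerfectAntiMatching : ∀ m (G : Graph (2 ^ suc m)) →
  DilAtMost G (suc m) m → HasPerfectAntiMatching G
DilAtMost⇒HasPerfectAntiMatching m G E = 2 ^ m , refl , antiMatching g g-injective g-nonAdj
  where
  open EmbeddingDil E

  φ : Fin (2 ^ suc m) ↔ Vec Bool (suc m)
  φ = ↣⇒↔ (mk↣ f-inj) (↣-id _) (↔⇒↣ (Vec-Bool↔Fin (suc m)))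

  code : Fin (2 ^ m) ⊎ Fin (2 ^ m) → Vec Bool (suc m)
  code = antipodalCode (to (Fin↣Vec-Bool m))

  g : Fin (2 ^ m) ⊎ Fin (2 ^ m) → Fin (2 ^ suc m)
  g = Inverse.from φ ∘ code

  g-injective : Injective _≡_ _≡_ g
  g-injective = antipodalCode-injective (injective (Fin↣Vec-Bool m)) ∘ injective (↔⇒↣ (↔-sym φ))

  g-nonAdj : ∀ i → ¬ Adj G (g (inj₁ i)) (g (inj₂ i))
  g-nonAdj i adj with P adj
  ... | ℓ , path , ℓ≤m = 1+n≰n (≤-trans (QPath-complement-length code-path) ℓ≤m)
    where
    code-path : QPath (code (inj₁ i)) (code (inj₂ i)) ℓ
    code-path = subst₂ (λ x y → QPath x y ℓ)
      (Inverse.strictlyInverseˡ φ _) (Inverse.strictlyInverseˡ φ _) path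

HasPerfectAntiMatching⇒DilAtMost : ∀ m (G : Graph (2 ^ suc m)) →
  HasPerfectAntiMatching G → DilAtMost G (suc m) m
HasPerfectAntiMatching⇒DilAtMost m G (k , 2k≡N , A) = record
  { f     = F
  ; f-inj = F-injective
  ; P     = λ {u} {v} adj → non-antipodal⇒short-QPath (F u) (F v) (F-non-antipodal adj)
  }
  where
  open AntiMatching A

  k+k≡N : k + k ≡ 2 ^ suc m
  k+k≡N = trans (cong (k +_) (sym (+-identityʳ k))) 2k≡N

  ψ : (Fin k ⊎ Fin k) ↔ Fin (2 ^ suc m)
  ψ = ↣⇒↔ (mk↣ distinct) (subst (λ j → Fin j ↣ (Fin k ⊎ Fin k)) k+k≡N (↔⇒↣ +↔⊎)) (↣-id _)

  label : Fin (2 ^ suc m) → Fin k ⊎ Fin k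
  label = Inverse.from ψ

  e : Fin k ↣ Vec Bool m
  e = subst (λ j → Fin j ↣ Vec Bool m) (sym (*-cancelˡ-≡ k (2 ^ m) 2 2k≡N)) (Fin↣Vec-Bool m)

  F : Fin (2 ^ suc m) → Vec Bool (suc m)
  F = antipodalCode (to e) ∘ label

  F-injective : Injective _≡_ _≡_ F
  F-injective = injective (↔⇒↣ (↔-sym ψ)) ∘ antipodalCode-injective (injective e)

  F-non-antipodal : ∀ {u v} → Adj G u v → F v ≢ map not (F u)
  F-non-antipodal {u} {v} adj Fv≡F̄u = AntiMatching-nonAdj-swap A (label u) (subst₂ (Adj G)
    (sym (Inverse.strictlyInverseˡ ψ u))
    (trans (sym (Inverse.strictlyInverseˡ ψ v))
           (cong (endpoint pair) (antipodalCode-complement⇒swap (injective e) Fv≡F̄u)))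
    adj)

theorem3p1 : (n : ℕ) → 1 ≤ n → (G : Graph (2 ^ n)) →
    DilAtMost G n (n ∸ 1) ⇔ HasPerfectAntiMatching G
theorem3p1 (suc m) _ G =
  mk⇔ (DilAtMost⇒HasPerfectAntiMatching m G) (HasPerfectAntiMatching⇒DilAtMost m G)
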